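{- Let $q$ be an odd prime and $n\ge 1$ an integer. Let $\mathcal{H}_0=\{(x_1,\dots,x_{n-1},0): x_i\in\mathbb{F}_q\}\subseteq\mathbb{F}_q^n$. Let $\mathcal{L}$ be a nonempty collection of lines (1-dimensional subspaces) $\ell$ of $\mathbb{F}_q^n$ each satisfying $\ell\cap\mathcal{H}_0=\{\mathbf{0}\}$, and let $S=\left(\bigcup_{\ell\in\mathcal{L}}\ell\right)\setminus\{\mathbf{0}\}$. Then the Cayley graph $G_{n,S}=\mathrm{Cay}(\mathbb{F}_q^n,S)$ has chromatic number $\chi(G_{n,S})=q$.
   Context: $\mathrm{Cay}(\mathbb{F}_q^n,S)$ is the graph with vertex set $\mathbb{F}_q^n$ in which $u,v$ are adjacent iff $u-v\in S$ (here $S=-S$ since $S$ is a union of lines minus the origin). $\mathbf{0}$ denotes the zero vector. -}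

module Defs where

open import Data.Nat using (ℕ; suc; NonZero; _<_)
open import Data.Nat.DivMod using (_mod_)
open import Data.Fin using (Fin; toℕ)
import Data.Fin as F
open import Data.Vec using (Vec; zipWith; map; replicate)
open import Data.List using (List)
open import Data.List.Membership.Propositional using (_∈_)
open import Data.Product using (_×_; ∃-syntax; Σ-syntax)
open import Relation.Binary.PropositionalEquality using (_≡_; _≢_)

module Field (q : ℕ) .{{_ : NonZero q}} where

  Fq : Set
  Fq = Fin q

  _+q_ : Fq → Fq → Fq
  a +q b = (toℕ a Data.Nat.+ toℕ b) mod q

  -q_ : Fq → Fq
  -q a = (q Data.Nat.∸ toℕ a) mod q

  _*q_ : Fq → Fq → Fq
  a *q b = (toℕ a Data.Nat.* toℕ b) mod q

  0q : Fq
  0q = 0 mod q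

  V : ℕ → Set
  V n = Vec Fq n

  0v : ∀ {n} → V n
  0v = replicate _ 0q

  _-v_ : ∀ {n} → V n → V n → V n
  u -v w = zipWith (λ a b → a +q (-q b)) u w

  _•_ : ∀ {n} → Fq → V n → V n
  c • v = map (c *q_) v

  InLine : ∀ {n} → V n → V n → Set
  InLine v x = ∃[ c ] x ≡ c • v

  -- A collection of lines, each given by a nonzero spanning vector.
  -- S = (⋃_{ℓ ∈ L} ℓ) \ {0}
  InS : ∀ {n} → List (V n) → V n → Set
  InS L x = (∃[ v ] (v ∈ L × InLine v x)) × x ≢ 0v

  CayAdj : ∀ {n} → List (V n) → V n → V n → Set
  CayAdj L u w = InS L (u -v w)

ProperColouring : {A : Set} → (A → A → Set) → (k : ℕ) → (A → Fin k) → Set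
ProperColouring Adj k c = ∀ u w → Adj u w → c u ≢ c w

Colourable : {A : Set} → (A → A → Set) → ℕ → Set
Colourable Adj k = ∃[ c ] ProperColouring Adj k c

ChromaticNumberIs : {A : Set} → (A → A → Set) → ℕ → Set
ChromaticNumberIs Adj k = Colourable Adj k × (∀ j → j < k → Colourable Adj j → Data.Empty.⊥)
  where import Data.Empty

module Submission where

-- Upper bound: the last coordinate is a proper q-colouring.  If u ~ w then
-- u - w is a nonzero point of some line of L; equal last coordinates would
-- put u - w in H₀, forcing u - w = 0.
--
-- Lower bound: any v ∈ L spans a line {c • v} of q points which is a clique,
-- because c • v - c' • v = (c - c') • v, and (c - c') • v ≠ 0 for c ≠ c'
-- since its last coordinate is (c - c') · last v, a product of nonzero
-- elements of the field (and last v ≠ 0 as v ∉ H₀).  A graph containing a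
-- q-clique has no proper j-colouring for j < q (pigeonhole).

open import Defs
open import Data.Nat using (ℕ; suc; NonZero)
open import Data.Nat.Divisibility using (_∣_)
open import Data.Nat.Primality using (Prime)
open import Data.Vec using (last)
open import Data.List using (List; [])
open import Data.List.Membership.Propositional using (_∈_)
open import Data.List.Relation.Unary.All using (All)
open import Relation.Nullary using (¬_)
open import Relation.Binary.PropositionalEquality using (_≡_; _≢_)

open import Data.Nat using (zero; _+_; _*_; _∸_; _%_; _<_)
open import Data.Nat.Properties
  using (+-assoc; +-identityʳ; *-identityˡ; *-distribʳ-+; m+[n∸m]≡n; <⇒≤; <⇒≱)
open import Data.Nat.DivMod
  using (_mod_; %-distribˡ-+; %-distribˡ-*; m%n%n≡m%n; n%n≡0; m*n%n≡0; m<n⇒m%n≡m; m%n<n)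
open import Data.Nat.Divisibility using (m%n≡0⇒n∣m; ∣⇒≤)
open import Data.Nat.Primality using (euclidsLemma)
open import Data.Fin using (Fin; toℕ)
open import Data.Fin.Properties using (toℕ-injective; toℕ-fromℕ<; toℕ<n; pigeonhole; <⇒≢)
open import Data.Vec using (Vec; []; _∷_; map; zipWith; replicate)
open import Data.Vec.Properties using (map-cong; map-id)
open import Data.List using (_∷_)
open import Data.List.Relation.Unary.Any using (here)
import Data.List.Relation.Unary.All as All
open import Data.Product using (_,_)
open import Data.Sum using (_⊎_; inj₁; inj₂)
open import Data.Empty using (⊥-elim)
open import Relation.Binary.PropositionalEquality
  using (refl; sym; trans; cong; cong₂; module ≡-Reasoning)

last-map : ∀ {A B : Set} {n} (f : A → B) (v : Vec A (suc n)) →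
  last (map f v) ≡ f (last v)
last-map f (x ∷ [])     = refl
last-map f (x ∷ y ∷ ys) = last-map f (y ∷ ys)

last-zipWith : ∀ {A B C : Set} {n} (f : A → B → C) (u : Vec A (suc n)) (w : Vec B (suc n)) →
  last (zipWith f u w) ≡ f (last u) (last w)
last-zipWith f (x ∷ [])      (y ∷ [])      = refl
last-zipWith f (x ∷ x' ∷ xs) (y ∷ y' ∷ ys) = last-zipWith f (x' ∷ xs) (y' ∷ ys)

last-replicate : ∀ {A : Set} n (a : A) → last (replicate (suc n) a) ≡ a
last-replicate zero    a = refl
last-replicate (suc n) a = last-replicate n a

clique⇒¬colourable : {A : Set} (Adj : A → A → Set) {k : ℕ} (f : Fin k → A) →
  (∀ i i' → i ≢ i' → Adj (f i) (f i')) →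
  ∀ j → j < k → ¬ Colourable Adj j
clique⇒¬colourable Adj f clique j j<k (colour , proper) =
  let (i , i' , i<i' , same) = pigeonhole j<k (λ i → colour (f i))
  in proper (f i) (f i') (clique i i' (<⇒≢ i<i')) same

module Residues (q : ℕ) .{{_ : NonZero q}} where
  open Field q

  -- Congruence modulo q on ℕ; the field operations of Fq are the ℕ
  -- operations read modulo q, so field identities reduce to congruences.

  infix 4 _≈_
  _≈_ : ℕ → ℕ → Set
  a ≈ b = a % q ≡ b % q

  +-cong : ∀ {a b c d} → a ≈ b → c ≈ d → a + c ≈ b + d
  +-cong {a} {b} {c} {d} a≈b c≈d = begin
    (a + c) % q               ≡⟨ %-distribˡ-+ a c q ⟩
    (a % q + c % q) % q       ≡⟨ cong₂ (λ x y → (x + y) % q) a≈b c≈d ⟩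
    (b % q + d % q) % q       ≡⟨ %-distribˡ-+ b d q ⟨
    (b + d) % q               ∎
    where open ≡-Reasoning

  *-cong : ∀ {a b c d} → a ≈ b → c ≈ d → a * c ≈ b * d
  *-cong {a} {b} {c} {d} a≈b c≈d = begin
    (a * c) % q               ≡⟨ %-distribˡ-* a c q ⟩
    (a % q * (c % q)) % q     ≡⟨ cong₂ (λ x y → (x * y) % q) a≈b c≈d ⟩
    (b % q * (d % q)) % q     ≡⟨ %-distribˡ-* b d q ⟨
    (b * d) % q               ∎
    where open ≡-Reasoning

  q≈0 : q ≈ 0
  q≈0 = trans (n%n≡0 q) (sym (m*n%n≡0 0 q))

  toℕ-mod : ∀ m → toℕ (m mod q) ≡ m % q
  toℕ-mod m = toℕ-fromℕ< (m%n<n m q)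

  toℕ-mod≈ : ∀ m → toℕ (m mod q) ≈ m
  toℕ-mod≈ m = trans (cong (_% q) (toℕ-mod m)) (m%n%n≡m%n m q)

  ≈⇒≡ : ∀ {a b : Fq} → toℕ a ≈ toℕ b → a ≡ b
  ≈⇒≡ {a} {b} a≈b = toℕ-injective
    (trans (sym (m<n⇒m%n≡m (toℕ<n a))) (trans a≈b (m<n⇒m%n≡m (toℕ<n b))))

  toℕ-0q : toℕ 0q ≈ 0
  toℕ-0q = toℕ-mod≈ 0

  _−q_ : Fq → Fq → Fq
  a −q b = a +q (-q b)

  -q-inverse : ∀ a → toℕ a + toℕ (-q a) ≈ 0
  -q-inverse a = begin
    (toℕ a + toℕ (-q a)) % q  ≡⟨ +-cong {toℕ a} refl (toℕ-mod≈ (q ∸ toℕ a)) ⟩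
    (toℕ a + (q ∸ toℕ a)) % q ≡⟨ cong (_% q) (m+[n∸m]≡n (<⇒≤ (toℕ<n a))) ⟩
    q % q                     ≡⟨ q≈0 ⟩
    0 % q                     ∎
    where open ≡-Reasoning

  +-cancelʳ : ∀ {x y} (b : Fq) → x + toℕ b ≈ y + toℕ b → x ≈ y
  +-cancelʳ {x} {y} b eq = begin
    x % q                               ≡⟨ cong (_% q) (+-identityʳ x) ⟨
    (x + 0) % q                         ≡⟨ +-cong {x} refl (-q-inverse b) ⟨
    (x + (toℕ b + toℕ (-q b))) % q      ≡⟨ cong (_% q) (+-assoc x _ _) ⟨
    (x + toℕ b + toℕ (-q b)) % q        ≡⟨ +-cong eq refl ⟩
    (y + toℕ b + toℕ (-q b)) % q        ≡⟨ cong (_% q) (+-assoc y _ _) ⟩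
    (y + (toℕ b + toℕ (-q b))) % q      ≡⟨ +-cong {y} refl (-q-inverse b) ⟩
    (y + 0) % q                         ≡⟨ cong (_% q) (+-identityʳ y) ⟩
    y % q                               ∎
    where open ≡-Reasoning

  −q-+ : ∀ a b → toℕ (a −q b) + toℕ b ≈ toℕ a
  −q-+ a b = +-cancelʳ {y = toℕ a} (-q b) (begin
    (toℕ (a −q b) + toℕ b + toℕ (-q b)) % q   ≡⟨ cong (_% q) (+-assoc (toℕ (a −q b)) _ _) ⟩
    (toℕ (a −q b) + (toℕ b + toℕ (-q b))) % q ≡⟨ +-cong {toℕ (a −q b)} refl (-q-inverse b) ⟩
    (toℕ (a −q b) + 0) % q                    ≡⟨ cong (_% q) (+-identityʳ _) ⟩
    toℕ (a −q b) % q                          ≡⟨ toℕ-mod≈ (toℕ a + toℕ (-q b)) ⟩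
    (toℕ a + toℕ (-q b)) % q                  ∎)
    where open ≡-Reasoning

  −q-self : ∀ a → a −q a ≡ 0q
  −q-self a = ≈⇒≡ (trans (toℕ-mod≈ (toℕ a + toℕ (-q a))) (trans (-q-inverse a) (sym toℕ-0q)))

  *q-distribʳ-−q : ∀ c c' a → (c *q a) −q (c' *q a) ≡ (c −q c') *q a
  *q-distribʳ-−q c c' a = ≈⇒≡ (+-cancelʳ (c' *q a) (begin
    (toℕ ((c *q a) −q (c' *q a)) + toℕ (c' *q a)) % q ≡⟨ −q-+ (c *q a) (c' *q a) ⟩
    toℕ (c *q a) % q                                  ≡⟨ toℕ-mod≈ (toℕ c * toℕ a) ⟩
    (toℕ c * toℕ a) % q                               ≡⟨ *-cong (−q-+ c c') refl ⟨
    ((toℕ (c −q c') + toℕ c') * toℕ a) % q            ≡⟨ cong (_% q) (*-distribʳ-+ (toℕ a) (toℕ (c −q c')) (toℕ c')) ⟩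
    (toℕ (c −q c') * toℕ a + toℕ c' * toℕ a) % q      ≡⟨ +-cong (toℕ-mod≈ (toℕ (c −q c') * toℕ a))
                                                                (toℕ-mod≈ (toℕ c' * toℕ a)) ⟨
    (toℕ ((c −q c') *q a) + toℕ (c' *q a)) % q        ∎))
    where open ≡-Reasoning

  -- c - c' = 0 forces c = c', since c ≡ (c - c') + c' (mod q).
  −q≡0⇒≡ : ∀ {c c'} → c −q c' ≡ 0q → c ≡ c'
  −q≡0⇒≡ {c} {c'} c−c'≡0 = ≈⇒≡ (begin
    toℕ c % q                        ≡⟨ −q-+ c c' ⟨
    (toℕ (c −q c') + toℕ c') % q     ≡⟨ +-cong (trans (cong (λ d → toℕ d % q) c−c'≡0) toℕ-0q) refl ⟩
    toℕ c' % q                       ∎)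
    where open ≡-Reasoning

  1q : Fq
  1q = 1 mod q

  *q-identityˡ : ∀ a → 1q *q a ≡ a
  *q-identityˡ a = ≈⇒≡ (trans (toℕ-mod≈ (toℕ 1q * toℕ a))
                      (trans (*-cong (toℕ-mod≈ 1) refl) (cong (_% q) (*-identityˡ (toℕ a)))))

  ∣⇒≡0q : ∀ (a : Fq) → q ∣ toℕ a → a ≡ 0q
  ∣⇒≡0q a q∣a = ≈⇒≡ (trans (cong (_% q) (toℕ≡0 (toℕ a) q∣a (toℕ<n a))) (sym toℕ-0q))
    where
    toℕ≡0 : ∀ n → q ∣ n → n < q → n ≡ 0
    toℕ≡0 zero    _   _   = refl
    toℕ≡0 (suc n) q∣n n<q = ⊥-elim (<⇒≱ n<q (∣⇒≤ q∣n))

  *q-≡0 : Prime q → ∀ d a → d *q a ≡ 0q → d ≡ 0q ⊎ a ≡ 0q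
  *q-≡0 q-prime d a da≡0 with euclidsLemma (toℕ d) (toℕ a) q-prime q∣da
    where
    q∣da : q ∣ toℕ d * toℕ a
    q∣da = m%n≡0⇒n∣m _ q (trans (sym (toℕ-mod _)) (trans (cong toℕ da≡0) (trans (toℕ-mod 0) (m*n%n≡0 0 q))))
  ... | inj₁ q∣d = inj₁ (∣⇒≡0q d q∣d)
  ... | inj₂ q∣a = inj₂ (∣⇒≡0q a q∣a)

  •-−q : ∀ {n} c c' (v : V n) → (c • v) -v (c' • v) ≡ (c −q c') • v
  •-−q c c' []      = refl
  •-−q c c' (a ∷ v) = cong₂ _∷_ (*q-distribʳ-−q c c' a) (•-−q c c' v)

  •-identityˡ : ∀ {n} (v : V n) → 1q • v ≡ v
  •-identityˡ v = trans (map-cong *q-identityˡ v) (map-id v)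

  last-•≡0 : ∀ {m} d (v : V (suc m)) → d • v ≡ 0v → d *q last v ≡ 0q
  last-•≡0 {m} d v dv≡0 = trans (sym (last-map (d *q_) v)) (trans (cong last dv≡0) (last-replicate m 0q))

  last--v : ∀ {m} (u w : V (suc m)) → last (u -v w) ≡ last u −q last w
  last--v = last-zipWith (λ a b → a +q (-q b))

  MeetsH₀Trivially : ∀ {m} → V (suc m) → Set
  MeetsH₀Trivially v = ∀ x → InLine v x → last x ≡ 0q → x ≡ 0v

  last-proper : ∀ {m} (L : List (V (suc m))) → All MeetsH₀Trivially L →
    ProperColouring (CayAdj L) q last
  last-proper L trivial u w ((v , v∈L , u-w∈line) , u-w≢0) same-last =
    u-w≢0 (All.lookup trivial v∈L (u -v w) u-w∈line (begin
      last (u -v w)          ≡⟨ last--v u w ⟩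
      last u −q last w       ≡⟨ cong (_−q last w) same-last ⟩
      last w −q last w       ≡⟨ −q-self (last w) ⟩
      0q                     ∎))
    where open ≡-Reasoning

  line-clique : Prime q → ∀ {m} {L : List (V (suc m))} {v} → v ∈ L →
    v ≢ 0v → MeetsH₀Trivially v →
    ∀ c c' → c ≢ c' → CayAdj L (c • v) (c' • v)
  line-clique q-prime {v = v} v∈L v≢0 trivial c c' c≢c' =
    (v , v∈L , c −q c' , •-−q c c' v) , difference≢0
    where
    last-v≢0 : last v ≢ 0q
    last-v≢0 last-v≡0 = v≢0 (trivial v (1q , sym (•-identityˡ v)) last-v≡0)

    difference≢0 : (c • v) -v (c' • v) ≢ 0v
    difference≢0 diff≡0
      with *q-≡0 q-prime (c −q c') (last v) (last-•≡0 (c −q c') v (trans (sym (•-−q c c' v)) diff≡0))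
    ... | inj₁ c−c'≡0 = c≢c' (−q≡0⇒≡ c−c'≡0)
    ... | inj₂ last-v≡0 = last-v≢0 last-v≡0

-- The theorem: the last coordinate gives a q-colouring, and any line of the
-- nonempty collection L is a q-clique, so fewer colours do not suffice.
lemma3p1 : (q : ℕ) .{{_ : NonZero q}} → Prime q → ¬ (2 ∣ q) →
    (m : ℕ) → let open Field q in
    (L : List (V (suc m))) → L ≢ [] →
    All (λ v → v ≢ 0v) L →
    All (λ v → ∀ x → InLine v x → last x ≡ 0q → x ≡ 0v) L →
    ChromaticNumberIs (CayAdj L) q
lemma3p1 q q-prime _ m L L≢[] nonzero trivial =
  (last , last-proper L trivial) , fewer-colours-fail L L≢[] nonzero trivial
  where
  open Field q
  open Residues q

  fewer-colours-fail : (L' : List (V (suc m))) → L' ≢ [] → All (λ v → v ≢ 0v) L' →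
    All MeetsH₀Trivially L' → ∀ j → j < q → ¬ Colourable (CayAdj L') j
  fewer-colours-fail []      []≢[] _ _ = ⊥-elim ([]≢[] refl)
  fewer-colours-fail (v ∷ _) _ (v≢0 All.∷ _) (v-trivial All.∷ _) =
    clique⇒¬colourable (CayAdj (v ∷ _)) (_• v) (line-clique q-prime (here refl) v≢0 v-trivial)
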